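{- For every integer $p\ge 2$, the complete bipartite graph $K_{2,p}$ admits a $(3p-2,p)$-configuration; consequently $FD(K_{2,p})\ge \frac{3p-2}{p}$.
   Context: A set is dominating if every vertex outside it has a neighbour in it. A $(k,s)$-configuration of a graph is a multiset of $k$ (not necessarily distinct) dominating sets such that every vertex lies in at most $s$ of them. $FD(G)$ is the maximum of $k/s$ over all $(k,s)$ for which $G$ admits a $(k,s)$-configuration. -}

module Defs where

open import Data.Nat using (ℕ; zero; suc; _+_; _*_; _∸_; _≤_; _<_)
open import Data.Fin using (Fin; toℕ)
open import Data.Fin.Subset using (Subset; _∈_; _∉_)
open import Data.Fin.Subset.Properties using (_∈?_)
open import Data.Product using (Σ; _×_; ∃)
open import Relation.Nullary using (¬_; yes; no)
open import Relation.Binary.PropositionalEquality using (_≡_)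

record Graph (n : ℕ) : Set₁ where
  field
    Adj     : Fin n → Fin n → Set
    sym     : ∀ {u v} → Adj u v → Adj v u
    irrefl  : ∀ {v} → ¬ Adj v v
open Graph public

-- K_{2,p}: vertices 0,1 form one side, vertices 2..p+1 the other side.
InFirst : ∀ {n} → Fin n → Set
InFirst v = toℕ v < 2

K2 : (p : ℕ) → Graph (2 + p)
K2 p = record
  { Adj    = λ u v → (InFirst u × ¬ InFirst v) Data.Sum.⊎ (¬ InFirst u × InFirst v)
  ; sym    = λ { (Data.Sum.inj₁ (a , b)) → Data.Sum.inj₂ (b , a)
               ; (Data.Sum.inj₂ (a , b)) → Data.Sum.inj₁ (b , a) }
  ; irrefl = λ { (Data.Sum.inj₁ (a , b)) → b a ; (Data.Sum.inj₂ (a , b)) → a b }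
  }
  where
  import Data.Sum
  open Data.Product using (_,_)

Dominating : ∀ {n} → Graph n → Subset n → Set
Dominating {n} G D = ∀ (v : Fin n) → v ∉ D → ∃ λ (u : Fin n) → u ∈ D × Adj G u v

countIn : ∀ {n k} → (Fin k → Subset n) → Fin n → ℕ
countIn {k = zero}  D v = 0
countIn {k = suc k} D v with v ∈? D Fin.zero
  where import Data.Fin as Fin
... | yes _ = suc (countIn (λ i → D (Data.Fin.suc i)) v)
... | no  _ = countIn (λ i → D (Data.Fin.suc i)) v

-- A (k,s)-configuration: a multiset of k dominating sets (a k-indexed family,
-- repetitions allowed) such that each vertex lies in at most s of them.
Configuration : ∀ {n} → Graph n → ℕ → ℕ → Set
Configuration {n} G k s =
  Σ (Fin k → Subset n) λ D →
    ((i : Fin k) → Dominating G (D i)) × ((v : Fin n) → countIn D v ≤ s)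

-- FD(G) ≥ a/b (b > 0): since FD(G) is the maximum of k/s over admissible (k,s)
-- (s ≥ 1), this holds iff some (k,s)-configuration with s ≥ 1 has k/s ≥ a/b,
-- i.e. k * b ≥ a * s.
FD≥ : ∀ {n} → Graph n → ℕ → ℕ → Set
FD≥ G a b = ∃ λ k → ∃ λ s → (1 ≤ s) × Configuration G k s × (a * s ≤ k * b)

-- Write p = q + 2. In K₂,ₚ any vertex set meeting both secondSides is dominating, and so is
-- the whole second side. Take q copies of the second side together with the 2p edges
-- of the graph: these are q + 2p = 3p − 2 dominating sets. A first-side vertex lies
-- only in its p edges, and a second-side vertex lies in the q copies and in one edge
-- through each of the two first-side vertices, so every vertex is covered p times.
module Submission where

open import Defs hiding (sym)
open import Data.Nat using (ℕ; zero; suc; _+_; _*_; _∸_; _≤_; _<?_; z≤n; s≤s)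
open import Data.Nat.Properties
  using (≤-refl; ≤-reflexive; ≤-trans; +-mono-≤; +-comm; +-identityʳ; n≤1+n)
open import Data.Product using (_×_; _,_)
open import Data.Sum using (inj₁; inj₂)
open import Data.Fin using (Fin; zero; suc; toℕ; splitAt)
open import Data.Fin.Properties using (0≢1+n; suc-injective)
open import Data.Fin.Subset using (Subset; _∈_; _∉_; ⁅_⁆; ⊤; outside)
open import Data.Fin.Subset.Properties using (_∈?_; ∈⊤; x∈⁅x⁆; x∈⁅y⁆⇒x≡y)
open import Data.Vec using (_∷_; here; there) renaming (_++_ to _++ᵛ_)
open import Data.Vec.Functional using (Vector; _++_; replicate)
open import Relation.Nullary using (¬_; yes; no; contradiction)
open import Relation.Binary.PropositionalEquality
  using (_≡_; _≗_; refl; sym; trans; cong; subst)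

private
  variable
    A : Set
    m n k s : ℕ

++-∘-suc : (xs : Vector A (suc m)) (ys : Vector A n) →
           (λ i → (xs ++ ys) (suc i)) ≗ (λ i → xs (suc i)) ++ ys
++-∘-suc {m = m} xs ys i with splitAt m i
... | inj₁ _ = refl
... | inj₂ _ = refl

++-all : {P : A → Set} (xs : Vector A m) (ys : Vector A n) →
         (∀ i → P (xs i)) → (∀ i → P (ys i)) → ∀ i → P ((xs ++ ys) i)
++-all {m = m} xs ys Pxs Pys i with splitAt m i
... | inj₁ j = Pxs j
... | inj₂ j = Pys j

countIn-cong : {D E : Fin k → Subset n} → D ≗ E → ∀ v → countIn D v ≡ countIn E v
countIn-cong {k = zero}  D≗E v = refl
countIn-cong {k = suc k} {D = D} {E} D≗E v with v ∈? D zero | v ∈? E zero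
... | yes _    | yes _    = cong suc (countIn-cong (λ i → D≗E (suc i)) v)
... | no  _    | no  _    = countIn-cong (λ i → D≗E (suc i)) v
... | yes v∈D₀ | no  v∉E₀ = contradiction (subst (v ∈_) (D≗E zero) v∈D₀) v∉E₀
... | no  v∉D₀ | yes v∈E₀ = contradiction (subst (v ∈_) (sym (D≗E zero)) v∈E₀) v∉D₀

countIn-++ : (D : Fin m → Subset n) (E : Fin k → Subset n) →
             ∀ v → countIn (D ++ E) v ≡ countIn D v + countIn E v
countIn-++ {m = zero}  D E v = refl
countIn-++ {m = suc m} D E v with v ∈? D zero
... | yes _ = cong suc tail-count
  where tail-count = trans (countIn-cong (++-∘-suc D E) v) (countIn-++ (λ i → D (suc i)) E v)
... | no  _ = trans (countIn-cong (++-∘-suc D E) v) (countIn-++ (λ i → D (suc i)) E v)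

countIn≤length : (D : Fin k → Subset n) → ∀ v → countIn D v ≤ k
countIn≤length {k = zero}  D v = z≤n
countIn≤length {k = suc k} D v with v ∈? D zero
... | yes _ = s≤s (countIn≤length (λ i → D (suc i)) v)
... | no  _ = ≤-trans (countIn≤length (λ i → D (suc i)) v) (n≤1+n k)

countIn≡0 : (D : Fin k → Subset n) → ∀ v → (∀ i → v ∉ D i) → countIn D v ≡ 0
countIn≡0 {k = zero}  D v v∉D = refl
countIn≡0 {k = suc k} D v v∉D with v ∈? D zero
... | yes v∈D₀ = contradiction v∈D₀ (v∉D zero)
... | no  _    = countIn≡0 (λ i → D (suc i)) v (λ i → v∉D (suc i))

countIn≤1 : (D : Fin k → Subset n) → ∀ v →
            (∀ i j → v ∈ D i → v ∈ D j → i ≡ j) → countIn D v ≤ 1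
countIn≤1 {k = zero}  D v unique = z≤n
countIn≤1 {k = suc k} D v unique with v ∈? D zero
... | yes v∈D₀ = ≤-reflexive (cong suc (countIn≡0 (λ i → D (suc i)) v
                   (λ i v∈Dᵢ₊₁ → 0≢1+n (unique zero (suc i) v∈D₀ v∈Dᵢ₊₁))))
... | no  _    = countIn≤1 (λ i → D (suc i)) v
                   (λ i j v∈Dᵢ v∈Dⱼ → suc-injective (unique (suc i) (suc j) v∈Dᵢ v∈Dⱼ))

configuration⇒FD≥ : {G : Graph n} → 1 ≤ s → Configuration G k s → FD≥ G k s
configuration⇒FD≥ 1≤s config = _ , _ , 1≤s , config , ≤-refl

zero-first : InFirst {2} zero
zero-first = s≤s z≤n

one-first : InFirst {2} (suc zero)
one-first = s≤s (s≤s z≤n)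

secondSide-notFirst : (j : Fin m) → ¬ InFirst {2 + m} (suc (suc j))
secondSide-notFirst j (s≤s (s≤s ()))

meetsBothSides⇒dominating : {D : Subset (2 + m)} {u w : Fin (2 + m)} →
  u ∈ D → InFirst u → w ∈ D → ¬ InFirst w → Dominating (K2 m) D
meetsBothSides⇒dominating {u = u} {w} u∈D u-first w∈D w-second v v∉D with toℕ v <? 2
... | yes v-first  = w , w∈D , inj₂ (w-second , v-first)
... | no  v-second = u , u∈D , inj₁ (u-first , v-second)

secondSide : Subset (2 + m)
secondSide = outside ∷ outside ∷ ⊤

∉secondSide⇒first : (v : Fin (2 + m)) → v ∉ secondSide → InFirst v
∉secondSide⇒first zero          _        = zero-first
∉secondSide⇒first (suc zero)    _        = one-first
∉secondSide⇒first (suc (suc j)) j∉second = contradiction (there (there ∈⊤)) j∉second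

secondSide-dominating : Dominating (K2 (suc m)) secondSide
secondSide-dominating {m} v v∉second =
  suc (suc zero) , there (there here) ,
  inj₂ (secondSide-notFirst {suc m} zero , ∉secondSide⇒first v v∉second)

edge : Fin 2 → Fin m → Subset (2 + m)
edge x i = ⁅ x ⁆ ++ᵛ ⁅ i ⁆

edge-dominating : (x : Fin 2) (i : Fin m) → Dominating (K2 m) (edge x i)
edge-dominating zero       i = meetsBothSides⇒dominating here zero-first
  (there (there (x∈⁅x⁆ i))) (secondSide-notFirst i)
edge-dominating (suc zero) i = meetsBothSides⇒dominating (there here) one-first
  (there (there (x∈⁅x⁆ i))) (secondSide-notFirst i)

edge-secondSide-unique : (x : Fin 2) (j : Fin m) → ∀ i i′ →
  suc (suc j) ∈ edge x i → suc (suc j) ∈ edge x i′ → i ≡ i′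
edge-secondSide-unique zero       j i i′ (there (there j∈i)) (there (there j∈i′)) =
  trans (sym (x∈⁅y⁆⇒x≡y i j∈i)) (x∈⁅y⁆⇒x≡y i′ j∈i′)
edge-secondSide-unique (suc zero) j i i′ (there (there j∈i)) (there (there j∈i′)) =
  trans (sym (x∈⁅y⁆⇒x≡y i j∈i)) (x∈⁅y⁆⇒x≡y i′ j∈i′)

module K₂,ₚ-Configuration (q : ℕ) where

  p : ℕ
  p = 2 + q

  secondSides : Fin q → Subset (2 + p)
  secondSides = replicate q secondSide

  edges₀ edges₁ : Fin p → Subset (2 + p)
  edges₀ = edge zero
  edges₁ = edge (suc zero)

  family : Fin (q + (p + p)) → Subset (2 + p)
  family = secondSides ++ (edges₀ ++ edges₁)

  family-dominating : ∀ i → Dominating (K2 p) (family i)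
  family-dominating =
    ++-all {P = Dominating (K2 p)} secondSides _ (λ _ → secondSide-dominating)
      (++-all {P = Dominating (K2 p)} edges₀ edges₁
        (edge-dominating zero) (edge-dominating (suc zero)))

  countIn-family : ∀ v → countIn family v ≡
    countIn secondSides v + (countIn edges₀ v + countIn edges₁ v)
  countIn-family v =
    trans (countIn-++ secondSides _ v)
      (cong (countIn secondSides v +_) (countIn-++ edges₀ edges₁ v))

  family-load : ∀ v → countIn family v ≤ p
  family-load v = subst (_≤ p) (sym (countIn-family v)) (load v)
    where
    load : ∀ v →
      countIn secondSides v + (countIn edges₀ v + countIn edges₁ v) ≤ p
    load zero = ≤-trans
      (+-mono-≤ (≤-reflexive (countIn≡0 secondSides zero (λ _ ())))
        (+-mono-≤ (countIn≤length edges₀ zero)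
          (≤-reflexive (countIn≡0 edges₁ zero (λ _ ())))))
      (≤-reflexive (+-identityʳ p))
    load (suc zero) = ≤-trans
      (+-mono-≤ (≤-reflexive (countIn≡0 secondSides (suc zero) (λ { _ (there ()) })))
        (+-mono-≤ (≤-reflexive (countIn≡0 edges₀ (suc zero) (λ { _ (there ()) })))
          (countIn≤length edges₁ (suc zero))))
      ≤-refl
    load (suc (suc j)) = ≤-trans
      (+-mono-≤ (countIn≤length secondSides (suc (suc j)))
        (+-mono-≤ (countIn≤1 edges₀ _ (edge-secondSide-unique zero j))
          (countIn≤1 edges₁ _ (edge-secondSide-unique (suc zero) j))))
      (≤-reflexive (+-comm q 2))

  -- 3 * p ∸ 2 computes to q + (p + (p + 0)).
  configuration : Configuration (K2 p) (3 * p ∸ 2) p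
  configuration = subst (λ k → Configuration (K2 p) k p)
    (cong (λ n → q + (p + n)) (sym (+-identityʳ p)))
    (family , family-dominating , family-load)

lemma17 : (p : ℕ) → 2 ≤ p →
    Configuration (K2 p) (3 * p ∸ 2) p × FD≥ (K2 p) (3 * p ∸ 2) p
lemma17 (suc zero)    (s≤s ())
lemma17 (suc (suc q)) _ =
  configuration , configuration⇒FD≥ {G = K2 p} (s≤s z≤n) configuration
  where open K₂,ₚ-Configuration q
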